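{- Fix a number of variables $r$. Let $P$ be any Laurent polynomial in $x_1,\ldots,x_r$ with integer coefficients and $p$ a prime. There is $B_{P,p}\in\mathbb{N}$, depending only on $p$ and $\deg(P)$, such that if there exists some $n\in\mathbb{N}$ with $p\mid\mathrm{ct}(P^n)$, then there exists $n_0\in\mathbb{N}$ with $n_0<B_{P,p}$ and $p\mid\mathrm{ct}(P^{n_0})$.
   Context: $\mathrm{ct}(Q)$ denotes the constant term of a Laurent polynomial $Q$; $\deg Q$ denotes the largest absolute value of any exponent of any single variable appearing in $Q$ (e.g. $\deg(5x^{ -3}y^{ -2}+2xy^{ -1})=3$). -}

module Defs where

open import Data.Nat using (ℕ; zero; suc; _⊔_)
open import Data.Integer as ℤ using (ℤ; +_; ∣_∣)
open import Data.Product using (_×_; _,_)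
open import Data.List using (List; []; _∷_; concatMap; map; foldr)
open import Data.Vec using (Vec; replicate; zipWith)
import Data.Vec.Properties as VecP
open import Relation.Nullary using (yes; no)

Monomial : ℕ → Set
Monomial r = Vec ℤ r

-- A Laurent polynomial in r variables with integer coefficients, given as a
-- formal finite sum of terms  c · x^e  (repetitions / zero terms allowed;
-- the polynomial denoted is the sum).
LaurentPoly : ℕ → Set
LaurentPoly r = List (ℤ × Monomial r)

one : ∀ {r} → LaurentPoly r
one = (+ 1 , replicate _ (+ 0)) ∷ []

_·_ : ∀ {r} → LaurentPoly r → LaurentPoly r → LaurentPoly r
P · Q = concatMap (λ { (a , e) → map (λ { (b , f) → (a ℤ.* b , zipWith ℤ._+_ e f) }) Q }) P

_^_ : ∀ {r} → LaurentPoly r → ℕ → LaurentPoly r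
P ^ zero  = one
P ^ suc n = P · (P ^ n)

coeff : ∀ {r} → LaurentPoly r → Monomial r → ℤ
coeff P e = foldr (λ { (a , f) s → addIf (VecP.≡-dec ℤ._≟_ f e) a s }) (+ 0) P
  where
  addIf : ∀ {A : Set} → Relation.Nullary.Dec A → ℤ → ℤ → ℤ
  addIf (yes _) a s = a ℤ.+ s
  addIf (no _)  a s = s

ct : ∀ {r} → LaurentPoly r → ℤ
ct P = coeff P (replicate _ (+ 0))

maxAbs : ∀ {r} → Monomial r → ℕ
maxAbs e = Data.Vec.foldr _ (λ z m → ∣ z ∣ ⊔ m) 0 e

-- deg P: largest absolute value of any exponent of any variable appearing
-- in P, i.e. among monomials whose (true) coefficient in P is nonzero.
deg : ∀ {r} → LaurentPoly r → ℕ
deg P = foldr (λ { (_ , e) m → contrib (coeff P e ℤ.≟ + 0) e ⊔ m }) 0 P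
  where
  contrib : ∀ {A : Set} {r} → Relation.Nullary.Dec A → Monomial r → ℕ
  contrib (yes _) e = 0
  contrib (no _)  e = maxAbs e

-- Modulo p, Frobenius and Fermat give P ^ p ≡ P(x₁ᵖ, …, x_rᵖ), hence
--   ct (Q · P ^ (a + p m)) ≡ ct (Λ (Q · P ^ a) · P ^ m),
-- where the Cartier operator Λ keeps the monomials whose exponents are all divisible by p and
-- divides those exponents by p. Reading the base-p digits of n from the least significant one
-- therefore drives a state Q from 1 through Q ↦ Λ (Q · P ^ a), and ct (P ^ n) ≡ ct (final state).
-- Every state has exponents bounded by deg P, so modulo p there are at most p ^ (2 deg P + 1) ^ r
-- states; cutting loops out of the digit string preserves the final state and leaves a string of at
-- most that length, i.e. an exponent n₀ < p ^ p ^ (2 deg P + 1) ^ r with ct (P ^ n₀) ≡ ct (P ^ n).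

module Submission where

open import Defs
open import Algebra.Bundles using (CommutativeSemiring)
open import Algebra.Structures using (IsCommutativeMonoid)
open import Algebra.Structures.Biased using (isCommutativeMonoidˡ; isCommutativeSemiringˡ)
open import Data.Digit using (Expansion; fromDigits; toDigits)
open import Data.Empty using (⊥-elim)
open import Data.Fin as Fin using (Fin; toℕ)
import Data.Fin.Properties as FinP
open import Data.Integer as ℤ using (ℤ; +_; -[1+_])
import Data.Integer.Properties as ℤP
open import Data.Integer.Divisibility using (_∣_)
import Data.Integer.Divisibility.Signed as Signed
open import Data.Integer.DivMod using (_%ℕ_; _/ℕ_; n%ℕd<d; a≡a%ℕn+[a/ℕn]*n)
open import Data.Integer.Tactic.RingSolver using (solve-∀)
open import Data.List as List using (List; []; _∷_; _++_)
import Data.List.Properties as ListP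
open import Data.List.Relation.Unary.All as All using (All; []; _∷_)
import Data.List.Relation.Unary.All.Properties as AllP
open import Data.List.Relation.Unary.Any as Any using (Any; here; there)
import Data.List.Relation.Unary.Any.Properties as AnyP
open import Data.List.Membership.Propositional using (_∈_)
open import Data.List.Membership.Propositional.Properties
  using (∈-map⁺; ∈-++⁺ˡ; ∈-++⁺ʳ; ∈-upTo⁺; ∈-cartesianProductWith⁺)
open import Data.Nat as ℕ using (ℕ; zero; suc; _!; _<_)
import Data.Nat.Properties as ℕP
import Data.Nat.Induction as ℕI
open import Induction.WellFounded using (Acc; acc)
open import Data.Nat.Combinatorics using (nCk≡n!/k![n-k]!; k![n∸k]!∣n!; nCn≡1)
  renaming (_C_ to _choose_)
open import Data.Nat.Divisibility as ℕ∣ using (∣⇒≤; ∣1⇒≡1; m∣m*n)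
open import Data.Nat.DivMod using (m/n*n≡m)
open import Data.Nat.Primality using (Prime; euclidsLemma; prime⇒nonTrivial; prime⇒nonZero)
open import Data.Product using (Σ; ∃; _×_; _,_; proj₁; proj₂)
open import Data.Sum using (inj₁; inj₂)
open import Data.Vec as Vec using (Vec; []; _∷_)
import Data.Vec.Properties as VecP
open import Function using (_∘_; _⇔_; mk⇔; Equivalence)
open import Relation.Binary.Core using (_Preserves₂_⟶_⟶_)
open import Relation.Binary.PropositionalEquality
  using (_≡_; _≢_; _≗_; refl; sym; trans; cong; cong₂; subst; subst₂; module ≡-Reasoning)
open import Relation.Binary.Bundles using (Setoid)
open import Relation.Binary.Structures using (IsEquivalence)
open import Relation.Nullary using (Dec; yes; no; ¬_; contradiction)
open import Relation.Nullary.Decidable using (decidable-stable; fromWitness)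

private variable
  r : ℕ
  A : Set

Term : ℕ → Set
Term r = ℤ × Monomial r

0ᵐ : Monomial r
0ᵐ = Vec.replicate _ (+ 0)

infixl 6 _⊕_ _⊝_
_⊕_ _⊝_ : Monomial r → Monomial r → Monomial r
_⊕_ = Vec.zipWith ℤ._+_
_⊝_ = Vec.zipWith ℤ._-_

scale : ℕ → Monomial r → Monomial r
scale k = Vec.map (ℤ._* + k)

⊕-comm : (e f : Monomial r) → e ⊕ f ≡ f ⊕ e
⊕-comm = VecP.zipWith-comm ℤP.+-comm

⊕-assoc : (e f g : Monomial r) → (e ⊕ f) ⊕ g ≡ e ⊕ (f ⊕ g)
⊕-assoc = VecP.zipWith-assoc ℤP.+-assoc

⊕-identityˡ : (e : Monomial r) → 0ᵐ ⊕ e ≡ e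
⊕-identityˡ = VecP.zipWith-identityˡ ℤP.+-identityˡ

⊕-⊝-cancelˡ : (f g : Monomial r) → (f ⊕ g) ⊝ f ≡ g
⊕-⊝-cancelˡ []      []      = refl
⊕-⊝-cancelˡ (a ∷ f) (b ∷ g) = cong₂ _∷_ (cancel a b) (⊕-⊝-cancelˡ f g)
  where cancel : ∀ a b → (a ℤ.+ b) ℤ.- a ≡ b
        cancel = solve-∀

⊝-⊕-cancel : (f e : Monomial r) → f ⊕ (e ⊝ f) ≡ e
⊝-⊕-cancel []      []      = refl
⊝-⊕-cancel (a ∷ f) (b ∷ e) = cong₂ _∷_ (cancel a b) (⊝-⊕-cancel f e)
  where cancel : ∀ a b → a ℤ.+ (b ℤ.- a) ≡ b
        cancel = solve-∀

⊕≡⇔≡⊝ : (f g e : Monomial r) → (f ⊕ g ≡ e) ⇔ (g ≡ e ⊝ f)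
⊕≡⇔≡⊝ f g e = mk⇔ (λ { refl → sym (⊕-⊝-cancelˡ f g) })
                  (λ { refl → ⊝-⊕-cancel f e })

⊝≡⇒⊝≡ : (e f g : Monomial r) → e ⊝ f ≡ g → e ⊝ g ≡ f
⊝≡⇒⊝≡ e f g e⊝f≡g = sym (Equivalence.to (⊕≡⇔≡⊝ g f e)
  (trans (⊕-comm g f) (Equivalence.from (⊕≡⇔≡⊝ f g e) (sym e⊝f≡g))))

scale-⊕ : ∀ k (e f : Monomial r) → scale k (e ⊕ f) ≡ scale k e ⊕ scale k f
scale-⊕ k []      []      = refl
scale-⊕ k (a ∷ e) (b ∷ f) = cong₂ _∷_ (ℤP.*-distribʳ-+ (+ k) a b) (scale-⊕ k e f)

scale-⊝ : ∀ k (e f : Monomial r) → scale k (e ⊝ f) ≡ scale k e ⊝ scale k f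
scale-⊝ k []      []      = refl
scale-⊝ k (a ∷ e) (b ∷ f) = cong₂ _∷_ (distrib a b (+ k)) (scale-⊝ k e f)
  where distrib : ∀ a b c → (a ℤ.- b) ℤ.* c ≡ a ℤ.* c ℤ.- b ℤ.* c
        distrib = solve-∀

scale-0ᵐ : ∀ k → scale k (0ᵐ {r}) ≡ 0ᵐ
scale-0ᵐ k = trans (VecP.map-replicate _ (+ 0) _) (cong (Vec.replicate _) (ℤP.*-zeroˡ (+ k)))

scale-zero : (e : Monomial r) → scale 0 e ≡ 0ᵐ
scale-zero []      = refl
scale-zero (a ∷ e) = cong₂ _∷_ (ℤP.*-zeroʳ a) (scale-zero e)

scale-suc : ∀ k (e : Monomial r) → scale (suc k) e ≡ e ⊕ scale k e
scale-suc k []      = refl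
scale-suc k (a ∷ e) = cong₂ _∷_ (expand a (+ k)) (scale-suc k e)
  where expand : ∀ a k → a ℤ.* (+ 1 ℤ.+ k) ≡ a ℤ.+ a ℤ.* k
        expand = solve-∀

scale-injective : ∀ k .{{_ : ℕ.NonZero k}} (e f : Monomial r) → scale k e ≡ scale k f → e ≡ f
scale-injective k []      []      _  = refl
scale-injective k (a ∷ e) (b ∷ f) eq =
  cong₂ _∷_ (ℤP.*-cancelʳ-≡ a b (+ k) (VecP.∷-injectiveˡ eq)) (scale-injective k e f (VecP.∷-injectiveʳ eq))

∑ : (A → ℤ) → List A → ℤ
∑ h []       = + 0
∑ h (x ∷ xs) = h x ℤ.+ ∑ h xs

∑-++ : (h : A → ℤ) (xs ys : List A) → ∑ h (xs ++ ys) ≡ ∑ h xs ℤ.+ ∑ h ys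
∑-++ h []       ys = sym (ℤP.+-identityˡ _)
∑-++ h (x ∷ xs) ys = trans (cong (λ s → h x ℤ.+ s) (∑-++ h xs ys)) (sym (ℤP.+-assoc (h x) _ _))

∑-map : ∀ {B : Set} (h : B → ℤ) (k : A → B) xs → ∑ h (List.map k xs) ≡ ∑ (h ∘ k) xs
∑-map h k []       = refl
∑-map h k (x ∷ xs) = cong (λ s → h (k x) ℤ.+ s) (∑-map h k xs)

∑-cong : {h k : A → ℤ} → (∀ x → h x ≡ k x) → ∀ xs → ∑ h xs ≡ ∑ k xs
∑-cong eq []       = refl
∑-cong eq (x ∷ xs) = cong₂ ℤ._+_ (eq x) (∑-cong eq xs)

∑-head-zero : (h : A → ℤ) (x : A) (xs : List A) → h x ≡ + 0 → ∑ h (x ∷ xs) ≡ ∑ h xs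
∑-head-zero h x xs hx≡0 = trans (cong (ℤ._+ ∑ h xs) hx≡0) (ℤP.+-identityˡ (∑ h xs))

∑-zero : (xs : List A) → ∑ (λ _ → + 0) xs ≡ + 0
∑-zero []       = refl
∑-zero (x ∷ xs) = trans (ℤP.+-identityˡ _) (∑-zero xs)

∑-+ : (h k : A → ℤ) (xs : List A) → ∑ (λ x → h x ℤ.+ k x) xs ≡ ∑ h xs ℤ.+ ∑ k xs
∑-+ h k []       = refl
∑-+ h k (x ∷ xs) = trans (cong (λ s → (h x ℤ.+ k x) ℤ.+ s) (∑-+ h k xs)) (shuffle (h x) (k x) _ _)
  where shuffle : ∀ a b c d → (a ℤ.+ b) ℤ.+ (c ℤ.+ d) ≡ (a ℤ.+ c) ℤ.+ (b ℤ.+ d)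
        shuffle = solve-∀

∑-*ˡ : ∀ a (h : A → ℤ) xs → a ℤ.* ∑ h xs ≡ ∑ (λ x → a ℤ.* h x) xs
∑-*ˡ a h []       = ℤP.*-zeroʳ a
∑-*ˡ a h (x ∷ xs) = trans (ℤP.*-distribˡ-+ a (h x) _) (cong (λ s → a ℤ.* h x ℤ.+ s) (∑-*ˡ a h xs))

∑-swap : ∀ {B : Set} (h : A → B → ℤ) xs ys →
         ∑ (λ x → ∑ (h x) ys) xs ≡ ∑ (λ y → ∑ (λ x → h x y) xs) ys
∑-swap h []       ys = sym (∑-zero ys)
∑-swap h (x ∷ xs) ys = trans (cong (λ s → ∑ (h x) ys ℤ.+ s) (∑-swap h xs ys))
                             (sym (∑-+ (h x) (λ y → ∑ (λ x → h x y) xs) ys))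

δ : Monomial r → Monomial r → ℤ
δ f e with VecP.≡-dec ℤ._≟_ f e
... | yes _ = + 1
... | no  _ = + 0

δ-cong : {f e g h : Monomial r} → (f ≡ e) ⇔ (g ≡ h) → δ f e ≡ δ g h
δ-cong {f = f} {e} {g} {h} f≡e⇔g≡h with VecP.≡-dec ℤ._≟_ f e | VecP.≡-dec ℤ._≟_ g h
... | yes _   | yes _   = refl
... | no  _   | no  _   = refl
... | yes f≡e | no  g≢h = contradiction (Equivalence.to f≡e⇔g≡h f≡e) g≢h
... | no  f≢e | yes g≡h = contradiction (Equivalence.from f≡e⇔g≡h g≡h) f≢e

δ-≢ : {f e : Monomial r} → f ≢ e → δ f e ≡ + 0
δ-≢ {f = f} {e} f≢e with VecP.≡-dec ℤ._≟_ f e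
... | yes f≡e = contradiction f≡e f≢e
... | no  _   = refl

coeffₜ : Monomial r → Term r → ℤ
coeffₜ e (a , f) = a ℤ.* δ f e

coeffₜ-≢ : ∀ a {f e : Monomial r} → f ≢ e → coeffₜ e (a , f) ≡ + 0
coeffₜ-≢ a f≢e = trans (cong (a ℤ.*_) (δ-≢ f≢e)) (ℤP.*-zeroʳ a)

coeff≡∑ : (P : LaurentPoly r) (e : Monomial r) → coeff P e ≡ ∑ (coeffₜ e) P
coeff≡∑ []            e = refl
coeff≡∑ ((a , f) ∷ P) e with VecP.≡-dec ℤ._≟_ f e
... | yes _ = cong₂ ℤ._+_ (sym (ℤP.*-identityʳ a)) (coeff≡∑ P e)
... | no  _ = trans (coeff≡∑ P e) (sym (trans (cong (ℤ._+ _) (ℤP.*-zeroʳ a)) (ℤP.+-identityˡ _)))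

infixl 7 _⊗_
_⊗_ : Term r → Term r → Term r
(a , e) ⊗ (b , f) = (a ℤ.* b , e ⊕ f)

⊗-comm : (s t : Term r) → s ⊗ t ≡ t ⊗ s
⊗-comm (a , e) (b , f) = cong₂ _,_ (ℤP.*-comm a b) (⊕-comm e f)

⊗-assoc : (s t u : Term r) → (s ⊗ t) ⊗ u ≡ s ⊗ (t ⊗ u)
⊗-assoc (a , e) (b , f) (c , g) = cong₂ _,_ (ℤP.*-assoc a b c) (⊕-assoc e f g)

∑-· : (h : Term r → ℤ) (A B : LaurentPoly r) →
      ∑ h (A · B) ≡ ∑ (λ s → ∑ (λ t → h (s ⊗ t)) B) A
∑-· h []      B = refl
∑-· h (s ∷ A) B = trans (∑-++ h (List.map (s ⊗_) B) (A · B))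
                        (cong₂ ℤ._+_ (∑-map h (s ⊗_) B) (∑-· h A B))

coeff-++ : (A B : LaurentPoly r) (e : Monomial r) → coeff (A ++ B) e ≡ coeff A e ℤ.+ coeff B e
coeff-++ A B e = begin
  coeff (A ++ B) e                        ≡⟨ coeff≡∑ (A ++ B) e ⟩
  ∑ (coeffₜ e) (A ++ B)                   ≡⟨ ∑-++ (coeffₜ e) A B ⟩
  ∑ (coeffₜ e) A ℤ.+ ∑ (coeffₜ e) B       ≡⟨ cong₂ ℤ._+_ (coeff≡∑ A e) (coeff≡∑ B e) ⟨
  coeff A e ℤ.+ coeff B e                 ∎
  where open ≡-Reasoning

coeff-· : (A B : LaurentPoly r) (e : Monomial r) →
          coeff (A · B) e ≡ ∑ (λ s → ∑ (λ t → coeffₜ e (s ⊗ t)) B) A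
coeff-· A B e = trans (coeff≡∑ (A · B) e) (∑-· (coeffₜ e) A B)

coeff-·-shift : (A B : LaurentPoly r) (e : Monomial r) →
                coeff (A · B) e ≡ ∑ (λ s → proj₁ s ℤ.* coeff B (e ⊝ proj₂ s)) A
coeff-·-shift A B e = trans (coeff-· A B e) (∑-cong inner A)
  where
  coeffₜ-⊗ : ∀ s t → coeffₜ e (s ⊗ t) ≡ proj₁ s ℤ.* coeffₜ (e ⊝ proj₂ s) t
  coeffₜ-⊗ (a , f) (b , g) =
    trans (ℤP.*-assoc a b _) (cong (λ z → a ℤ.* (b ℤ.* z)) (δ-cong (⊕≡⇔≡⊝ f g e)))
  inner : ∀ s → ∑ (λ t → coeffₜ e (s ⊗ t)) B ≡ proj₁ s ℤ.* coeff B (e ⊝ proj₂ s)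
  inner s = trans (∑-cong (coeffₜ-⊗ s) B)
                  (trans (sym (∑-*ˡ (proj₁ s) _ B)) (cong (proj₁ s ℤ.*_) (sym (coeff≡∑ B _))))

coeff-·-comm : (A B : LaurentPoly r) → coeff (A · B) ≗ coeff (B · A)
coeff-·-comm A B e = begin
  coeff (A · B) e                                       ≡⟨ coeff-· A B e ⟩
  ∑ (λ s → ∑ (λ t → coeffₜ e (s ⊗ t)) B) A             ≡⟨ ∑-swap _ A B ⟩
  ∑ (λ t → ∑ (λ s → coeffₜ e (s ⊗ t)) A) B
    ≡⟨ ∑-cong (λ t → ∑-cong (λ s → cong (coeffₜ e) (⊗-comm s t)) A) B ⟩
  ∑ (λ t → ∑ (λ s → coeffₜ e (t ⊗ s)) A) B             ≡⟨ coeff-· B A e ⟨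
  coeff (B · A) e                                       ∎
  where open ≡-Reasoning

coeff-·-assoc : (A B C : LaurentPoly r) → coeff ((A · B) · C) ≗ coeff (A · (B · C))
coeff-·-assoc A B C e = begin
  coeff ((A · B) · C) e                                         ≡⟨ coeff-· (A · B) C e ⟩
  ∑ (λ x → ∑ (λ u → coeffₜ e (x ⊗ u)) C) (A · B)                ≡⟨ ∑-· _ A B ⟩
  ∑ (λ s → ∑ (λ t → ∑ (λ u → coeffₜ e ((s ⊗ t) ⊗ u)) C) B) A    ≡⟨ ∑-cong reassociate A ⟩
  ∑ (λ s → ∑ (λ y → coeffₜ e (s ⊗ y)) (B · C)) A                ≡⟨ coeff-· A (B · C) e ⟨
  coeff (A · (B · C)) e                                         ∎
  where
  open ≡-Reasoning
  reassociate : ∀ s → ∑ (λ t → ∑ (λ u → coeffₜ e ((s ⊗ t) ⊗ u)) C) B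
                    ≡ ∑ (λ y → coeffₜ e (s ⊗ y)) (B · C)
  reassociate s = trans (∑-cong (λ t → ∑-cong (λ u → cong (coeffₜ e) (⊗-assoc s t u)) C) B)
                        (sym (∑-· (λ y → coeffₜ e (s ⊗ y)) B C))

·-identityˡ : (P : LaurentPoly r) → one · P ≡ P
·-identityˡ P = trans (ListP.++-identityʳ _) (trans (ListP.map-cong unit P) (ListP.map-id P))
  where unit : ∀ t → (+ 1 , 0ᵐ) ⊗ t ≡ t
        unit (b , f) = cong₂ _,_ (ℤP.*-identityˡ b) (⊕-identityˡ f)

·-distribʳ : (A B C : LaurentPoly r) → (A ++ B) · C ≡ A · C ++ B · C
·-distribʳ []      B C = refl
·-distribʳ (s ∷ A) B C = trans (cong (List.map (s ⊗_) C ++_) (·-distribʳ A B C))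
                               (sym (ListP.++-assoc (List.map (s ⊗_) C) (A · C) (B · C)))

maxAbs-⊕ : (e f : Monomial r) → maxAbs (e ⊕ f) ℕ.≤ maxAbs e ℕ.+ maxAbs f
maxAbs-⊕ []      []      = ℕ.z≤n
maxAbs-⊕ (a ∷ e) (b ∷ f) = ℕP.⊔-lub
  (ℕP.≤-trans (ℤP.∣i+j∣≤∣i∣+∣j∣ a b) (ℕP.+-mono-≤ (ℕP.m≤m⊔n ℤ.∣ a ∣ _) (ℕP.m≤m⊔n ℤ.∣ b ∣ _)))
  (ℕP.≤-trans (maxAbs-⊕ e f) (ℕP.+-mono-≤ (ℕP.m≤n⊔m ℤ.∣ a ∣ _) (ℕP.m≤n⊔m ℤ.∣ b ∣ _)))

maxAbs-0ᵐ : maxAbs (0ᵐ {r}) ≡ 0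
maxAbs-0ᵐ {zero}  = refl
maxAbs-0ᵐ {suc r} = maxAbs-0ᵐ {r}

maxAbs-scale : ∀ k (e : Monomial r) → maxAbs (scale k e) ≡ maxAbs e ℕ.* k
maxAbs-scale k []      = refl
maxAbs-scale k (a ∷ e) = trans (cong₂ ℕ._⊔_ (ℤP.abs-* a (+ k)) (maxAbs-scale k e))
                               (sym (ℕP.*-distribʳ-⊔ k ℤ.∣ a ∣ (maxAbs e)))

Bounded : ℕ → LaurentPoly r → Set
Bounded d = All λ (_ , f) → maxAbs f ℕ.≤ d

Bounded-one : ∀ d → Bounded d (one {r})
Bounded-one {r} d = subst (ℕ._≤ d) (sym (maxAbs-0ᵐ {r})) ℕ.z≤n ∷ []

Bounded-mono : ∀ {d d′} {Q : LaurentPoly r} → d ℕ.≤ d′ → Bounded d Q → Bounded d′ Q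
Bounded-mono d≤d′ = All.map (λ f≤d → ℕP.≤-trans f≤d d≤d′)

Bounded-· : ∀ {d₁ d₂} (A B : LaurentPoly r) →
            Bounded d₁ A → Bounded d₂ B → Bounded (d₁ ℕ.+ d₂) (A · B)
Bounded-· []            B []         _  = []
Bounded-· ((a , f) ∷ A) B (f≤ ∷ A≤) B≤ = AllP.++⁺
  (AllP.map⁺ (All.map (λ g≤ → ℕP.≤-trans (maxAbs-⊕ f _) (ℕP.+-mono-≤ f≤ g≤)) B≤))
  (Bounded-· A B A≤ B≤)

Bounded-^ : ∀ {d} (P : LaurentPoly r) n → Bounded d P → Bounded (n ℕ.* d) (P ^ n)
Bounded-^ P zero    _  = Bounded-one 0
Bounded-^ P (suc n) P≤ = Bounded-· P (P ^ n) P≤ (Bounded-^ P n P≤)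

coeff-outside : ∀ {d} (Q : LaurentPoly r) {e} → Bounded d Q → ¬ maxAbs e ℕ.≤ d → coeff Q e ≡ + 0
coeff-outside Q {e} Q≤ e≰d = trans (coeff≡∑ Q e) (go Q Q≤)
  where
  go : ∀ Q → Bounded _ Q → ∑ (coeffₜ e) Q ≡ + 0
  go []            []         = refl
  go ((a , f) ∷ Q) (f≤ ∷ Q≤) = cong₂ ℤ._+_ (coeffₜ-≢ a λ { refl → e≰d f≤ }) (go Q Q≤)

-- The listed terms of P may cancel beyond deg P; restricting to deg P keeps every coefficient
-- (coeff-restrict-deg) and makes the bound hold termwise.
restrict : ℕ → LaurentPoly r → LaurentPoly r
restrict d []            = []
restrict d ((a , f) ∷ P) with maxAbs f ℕ.≤? d
... | yes _ = (a , f) ∷ restrict d P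
... | no  _ = restrict d P

Bounded-restrict : ∀ d (P : LaurentPoly r) → Bounded d (restrict d P)
Bounded-restrict d []            = []
Bounded-restrict d ((a , f) ∷ P) with maxAbs f ℕ.≤? d
... | yes f≤d = f≤d ∷ Bounded-restrict d P
... | no  _   = Bounded-restrict d P

coeff-restrict : ∀ d (P : LaurentPoly r) {e} → maxAbs e ℕ.≤ d → coeff (restrict d P) e ≡ coeff P e
coeff-restrict d P {e} e≤d = trans (coeff≡∑ (restrict d P) e) (trans (go P) (sym (coeff≡∑ P e)))
  where
  go : ∀ P → ∑ (coeffₜ e) (restrict d P) ≡ ∑ (coeffₜ e) P
  go []            = refl
  go ((a , f) ∷ P) with maxAbs f ℕ.≤? d
  ... | yes _   = cong (λ s → a ℤ.* δ f e ℤ.+ s) (go P)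
  ... | no  f≰d = trans (go P) (sym (∑-head-zero (coeffₜ e) (a , f) P (coeffₜ-≢ a λ { refl → f≰d e≤d })))

coeff≢0⇒term : (P : LaurentPoly r) {e : Monomial r} → coeff P e ≢ + 0 → Any (λ (_ , f) → f ≡ e) P
coeff≢0⇒term []            c≢0 = contradiction refl c≢0
coeff≢0⇒term ((a , f) ∷ P) {e} c≢0 with VecP.≡-dec ℤ._≟_ f e
... | yes f≡e = here f≡e
... | no  _   = there (coeff≢0⇒term P c≢0)

-- Names the anonymous step function of the fold defining deg.
deg-as-foldr : (P : LaurentPoly r) → Σ (Term r → ℕ → ℕ) λ H → deg P ≡ List.foldr H 0 P
deg-as-foldr P = _ , refl

coeff≢0⇒≤deg : (P : LaurentPoly r) {e : Monomial r} → coeff P e ≢ + 0 → maxAbs e ℕ.≤ deg P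
coeff≢0⇒≤deg {r} P {e} c≢0 =
  subst (maxAbs e ℕ.≤_) (sym (proj₂ (deg-as-foldr P))) (go P (coeff≢0⇒term P c≢0))
  where
  H : Term r → ℕ → ℕ
  H = proj₁ (deg-as-foldr P)
  counts-e : ∀ b m → maxAbs e ℕ.≤ H (b , e) m
  counts-e b m with coeff P e ℤ.≟ + 0
  ... | yes c≡0 = contradiction c≡0 c≢0
  ... | no  _   = ℕP.m≤m⊔n (maxAbs e) m
  go : ∀ L → Any (λ (_ , f) → f ≡ e) L → maxAbs e ℕ.≤ List.foldr H 0 L
  go ((b , f) ∷ L) (here refl) = counts-e b _
  go (t ∷ L)       (there e∈L) = ℕP.≤-trans (go L e∈L) (ℕP.m≤n⊔m _ _)

coeff-restrict-deg : (P : LaurentPoly r) → coeff (restrict (deg P) P) ≗ coeff P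
coeff-restrict-deg P e with maxAbs e ℕ.≤? deg P
... | yes e≤deg = coeff-restrict (deg P) P e≤deg
... | no  e≰deg = trans (coeff-outside (restrict (deg P) P) (Bounded-restrict (deg P) P) e≰deg)
                        (sym (decidable-stable (coeff P e ℤ.≟ + 0) λ c≢0 → e≰deg (coeff≢0⇒≤deg P c≢0)))

range : ℕ → List ℤ
range d = List.map +_ (List.upTo (suc d)) ++ List.map -[1+_] (List.upTo d)

∈-range : ∀ {d} z → ℤ.∣ z ∣ ℕ.≤ d → z ∈ range d
∈-range     (+ i)    i≤d = ∈-++⁺ˡ (∈-map⁺ +_ (∈-upTo⁺ (ℕ.s≤s i≤d)))
∈-range {d} -[1+ i ] i<d = ∈-++⁺ʳ (List.map +_ (List.upTo (suc d))) (∈-map⁺ -[1+_] (∈-upTo⁺ i<d))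

box : ∀ r → ℕ → List (Monomial r)
box zero    d = [] ∷ []
box (suc r) d = List.cartesianProductWith _∷_ (range d) (box r d)

∈-box : ∀ {d} (e : Monomial r) → maxAbs e ℕ.≤ d → e ∈ box r d
∈-box []      _   = here refl
∈-box (z ∷ e) e≤d = ∈-cartesianProductWith⁺ _∷_ (∈-range z (ℕP.≤-trans (ℕP.m≤m⊔n _ _) e≤d))
                                                (∈-box e (ℕP.≤-trans (ℕP.m≤n⊔m ℤ.∣ z ∣ _) e≤d))

module IntegersModulo (m : ℕ) where

  infix 4 _≋_
  record _≋_ (a b : ℤ) : Set where
    constructor mk≋
    field divides-difference : + m Signed.∣ a ℤ.- b

  ≡⇒≋ : {a b : ℤ} → a ≡ b → a ≋ b
  ≡⇒≋ {a} refl = mk≋ (Signed.divides (+ 0) (ℤP.+-inverseʳ a))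

  ≋-refl : {a : ℤ} → a ≋ a
  ≋-refl = ≡⇒≋ refl

  ≋-sym : {a b : ℤ} → a ≋ b → b ≋ a
  ≋-sym {a} {b} (mk≋ m∣a-b) = mk≋ (subst (+ m Signed.∣_) (negate a b) (Signed.∣m⇒∣-m m∣a-b))
    where negate : ∀ a b → ℤ.- (a ℤ.- b) ≡ b ℤ.- a
          negate = solve-∀

  ≋-trans : {a b c : ℤ} → a ≋ b → b ≋ c → a ≋ c
  ≋-trans {a} {b} {c} (mk≋ m∣a-b) (mk≋ m∣b-c) =
    mk≋ (subst (+ m Signed.∣_) (ℤP.+-minus-telescope a b c) (Signed.∣m∣n⇒∣m+n m∣a-b m∣b-c))

  ≋-isEquivalence : IsEquivalence _≋_
  ≋-isEquivalence = record { refl = ≋-refl ; sym = ≋-sym ; trans = ≋-trans }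

  ≋-setoid : Setoid _ _
  ≋-setoid = record { isEquivalence = ≋-isEquivalence }

  +-cong : ℤ._+_ Preserves₂ _≋_ ⟶ _≋_ ⟶ _≋_
  +-cong {a} {b} {c} {d} (mk≋ m∣a-b) (mk≋ m∣c-d) =
    mk≋ (subst (+ m Signed.∣_) (regroup a b c d) (Signed.∣m∣n⇒∣m+n m∣a-b m∣c-d))
    where regroup : ∀ a b c d → (a ℤ.- b) ℤ.+ (c ℤ.- d) ≡ (a ℤ.+ c) ℤ.- (b ℤ.+ d)
          regroup = solve-∀

  +-cancelʳ-≋ : ∀ {a b c} → a ℤ.+ c ≋ b ℤ.+ c → a ≋ b
  +-cancelʳ-≋ {a} {b} {c} (mk≋ m∣d) = mk≋ (subst (+ m Signed.∣_) (cancel a b c) m∣d)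
    where cancel : ∀ a b c → (a ℤ.+ c) ℤ.- (b ℤ.+ c) ≡ a ℤ.- b
          cancel = solve-∀

  *-congˡ : ∀ c {a b} → a ≋ b → c ℤ.* a ≋ c ℤ.* b
  *-congˡ c {a} {b} (mk≋ m∣a-b) = mk≋ (subst (+ m Signed.∣_) (distrib c a b) (Signed.∣n⇒∣m*n c m∣a-b))
    where distrib : ∀ c a b → c ℤ.* (a ℤ.- b) ≡ c ℤ.* a ℤ.- c ℤ.* b
          distrib = solve-∀

  *-congʳ : ∀ c {a b} → a ≋ b → a ℤ.* c ≋ b ℤ.* c
  *-congʳ c {a} {b} a≋b = subst₂ _≋_ (ℤP.*-comm c a) (ℤP.*-comm c b) (*-congˡ c a≋b)

  *-cong : ℤ._*_ Preserves₂ _≋_ ⟶ _≋_ ⟶ _≋_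
  *-cong {a} {b} {c} {d} a≋b c≋d = ≋-trans (*-congˡ a c≋d) (*-congʳ d a≋b)

  ≋0⇒∣ : ∀ {a} → a ≋ + 0 → + m ∣ a
  ≋0⇒∣ {a} (mk≋ m∣a-0) = Signed.∣⇒∣ᵤ (subst (+ m Signed.∣_) (ℤP.+-identityʳ a) m∣a-0)

  ∣⇒≋0 : ∀ {a} → + m ∣ a → a ≋ + 0
  ∣⇒≋0 {a} m∣a = mk≋ (subst (+ m Signed.∣_) (sym (ℤP.+-identityʳ a)) (Signed.∣ᵤ⇒∣ m∣a))

  ∑-cong-≋ : {h k : A → ℤ} → (∀ x → h x ≋ k x) → ∀ xs → ∑ h xs ≋ ∑ k xs
  ∑-cong-≋ h≋k []       = ≋-refl
  ∑-cong-≋ h≋k (x ∷ xs) = +-cong (h≋k x) (∑-cong-≋ h≋k xs)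

  private
    coarsen : ∀ {_∙_ ε} → _∙_ Preserves₂ _≋_ ⟶ _≋_ ⟶ _≋_ →
              IsCommutativeMonoid _≡_ _∙_ ε → IsCommutativeMonoid _≋_ _∙_ ε
    coarsen ∙-cong M = isCommutativeMonoidˡ record
      { isSemigroup = record
        { isMagma = record { isEquivalence = ≋-isEquivalence ; ∙-cong = ∙-cong }
        ; assoc   = λ x y z → ≡⇒≋ (M.assoc x y z) }
      ; identityˡ = λ x → ≡⇒≋ (M.identityˡ x)
      ; comm      = λ x y → ≡⇒≋ (M.comm x y) }
      where module M = IsCommutativeMonoid M

  ℤ/mℤ : CommutativeSemiring _ _
  ℤ/mℤ = record
    { Carrier = ℤ ; _≈_ = _≋_ ; _+_ = ℤ._+_ ; _*_ = ℤ._*_ ; 0# = + 0 ; 1# = + 1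
    ; isCommutativeSemiring = isCommutativeSemiringˡ record
      { +-isCommutativeMonoid = coarsen +-cong ℤP.+-0-isCommutativeMonoid
      ; *-isCommutativeMonoid = coarsen *-cong ℤP.*-1-isCommutativeMonoid
      ; distribʳ = λ c a b → ≡⇒≋ (ℤP.*-distribʳ-+ c a b)
      ; zeroˡ    = λ a → ≡⇒≋ (ℤP.*-zeroˡ a) } }

module LaurentPolynomialsModulo (m r : ℕ) where

  open IntegersModulo m

  infix 4 _≈_
  record _≈_ (A B : LaurentPoly r) : Set where
    constructor mk≈
    field coeff-≋ : ∀ e → coeff A e ≋ coeff B e

  ≗⇒≈ : {A B : LaurentPoly r} → coeff A ≗ coeff B → A ≈ B
  ≗⇒≈ eq = mk≈ (λ e → ≡⇒≋ (eq e))

  ≡⇒≈ : {A B : LaurentPoly r} → A ≡ B → A ≈ B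
  ≡⇒≈ refl = ≗⇒≈ (λ _ → refl)

  ≈-refl : {A : LaurentPoly r} → A ≈ A
  ≈-refl = ≡⇒≈ refl

  ≈-sym : {A B : LaurentPoly r} → A ≈ B → B ≈ A
  ≈-sym (mk≈ A≋B) = mk≈ (λ e → ≋-sym (A≋B e))

  ≈-trans : {A B C : LaurentPoly r} → A ≈ B → B ≈ C → A ≈ C
  ≈-trans (mk≈ A≋B) (mk≈ B≋C) = mk≈ (λ e → ≋-trans (A≋B e) (B≋C e))

  ≈-isEquivalence : IsEquivalence _≈_
  ≈-isEquivalence = record { refl = ≈-refl ; sym = ≈-sym ; trans = ≈-trans }

  ++-cong : _++_ Preserves₂ _≈_ ⟶ _≈_ ⟶ _≈_
  ++-cong {A} {A′} {B} {B′} (mk≈ A≋A′) (mk≈ B≋B′) = mk≈ λ e →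
    subst₂ _≋_ (sym (coeff-++ A B e)) (sym (coeff-++ A′ B′ e)) (+-cong (A≋A′ e) (B≋B′ e))

  term-cong : ∀ {a b} (f : Monomial r) → a ≋ b → (a , f) ∷ [] ≈ (b , f) ∷ []
  term-cong {a} {b} f a≋b = mk≈ λ e →
    subst₂ _≋_ (sym (coeff≡∑ ((a , f) ∷ []) e)) (sym (coeff≡∑ ((b , f) ∷ []) e))
               (+-cong (*-congʳ (δ f e) a≋b) ≋-refl)

  ·-congˡ : ∀ A {B B′} → B ≈ B′ → A · B ≈ A · B′
  ·-congˡ A {B} {B′} (mk≈ B≋B′) = mk≈ λ e →
    subst₂ _≋_ (sym (coeff-·-shift A B e)) (sym (coeff-·-shift A B′ e))
      (∑-cong-≋ (λ s → *-congˡ (proj₁ s) (B≋B′ _)) A)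

  ·-cong : _·_ Preserves₂ _≈_ ⟶ _≈_ ⟶ _≈_
  ·-cong {A} {A′} {B} {B′} A≈A′ B≈B′ =
    ≈-trans (·-congˡ A B≈B′) (≈-trans (≗⇒≈ (coeff-·-comm A B′))
      (≈-trans (·-congˡ B′ A≈A′) (≗⇒≈ (coeff-·-comm B′ A′))))

  Poly : CommutativeSemiring _ _
  Poly = record
    { Carrier = LaurentPoly r ; _≈_ = _≈_ ; _+_ = _++_ ; _*_ = _·_ ; 0# = [] ; 1# = one
    ; isCommutativeSemiring = isCommutativeSemiringˡ record
      { +-isCommutativeMonoid = isCommutativeMonoidˡ record
        { isSemigroup = record
          { isMagma = record { isEquivalence = ≈-isEquivalence ; ∙-cong = ++-cong }
          ; assoc   = λ A B C → ≡⇒≈ (ListP.++-assoc A B C) }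
        ; identityˡ = λ A → ≈-refl
        ; comm      = λ A B → ≗⇒≈ λ e →
            trans (coeff-++ A B e) (trans (ℤP.+-comm (coeff A e) _) (sym (coeff-++ B A e))) }
      ; *-isCommutativeMonoid = isCommutativeMonoidˡ record
        { isSemigroup = record
          { isMagma = record { isEquivalence = ≈-isEquivalence ; ∙-cong = ·-cong }
          ; assoc   = λ A B C → ≗⇒≈ (coeff-·-assoc A B C) }
        ; identityˡ = λ A → ≡⇒≈ (·-identityˡ A)
        ; comm      = λ A B → ≗⇒≈ (coeff-·-comm A B) }
      ; distribʳ = λ C A B → ≡⇒≈ (·-distribʳ A B C)
      ; zeroˡ    = λ A → ≈-refl } }

  open CommutativeSemiring Poly using (semiring)
  open import Algebra.Properties.Semiring.Exp semiring using (^-homo-*; ^-assocʳ; ^-congˡ) renaming (_^_ to _^ₛ_)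

  ^ₛ≡^ : ∀ P n → P ^ₛ n ≡ P ^ n
  ^ₛ≡^ P zero    = refl
  ^ₛ≡^ P (suc n) = cong (P ·_) (^ₛ≡^ P n)

  ^-+ : ∀ P m n → P ^ (m ℕ.+ n) ≈ (P ^ m) · (P ^ n)
  ^-+ P m n = subst₂ _≈_ (^ₛ≡^ P (m ℕ.+ n)) (cong₂ _·_ (^ₛ≡^ P m) (^ₛ≡^ P n)) (^-homo-* P m n)

  ^-* : ∀ P m n → P ^ (m ℕ.* n) ≈ (P ^ m) ^ n
  ^-* P m n = subst₂ _≈_ (^ₛ≡^ P (m ℕ.* n)) (trans (^ₛ≡^ _ n) (cong (_^ n) (^ₛ≡^ P m)))
                         (≈-sym (^-assocʳ P m n))

  ^-cong : ∀ {A B} n → A ≈ B → A ^ n ≈ B ^ n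
  ^-cong {A} {B} n A≈B = subst₂ _≈_ (^ₛ≡^ A n) (^ₛ≡^ B n) (^-congˡ n A≈B)

  ct-cong : {A B : LaurentPoly r} → A ≈ B → ct A ≋ ct B
  ct-cong (mk≈ A≋B) = A≋B 0ᵐ

prime>1 : ∀ {p} → Prime p → 1 ℕ.< p
prime>1 {p} p-prime = ℕ.nonTrivial⇒n>1 p {{prime⇒nonTrivial p-prime}}

prime∤! : ∀ {p n} → Prime p → n ℕ.< p → ¬ p ℕ∣.∣ n !
prime∤! {n = zero}  p-prime _   p∣1   = ℕP.<⇒≢ (prime>1 p-prime) (sym (∣1⇒≡1 p∣1))
prime∤! {n = suc n} p-prime n<p p∣n! with euclidsLemma (suc n) (n !) p-prime p∣n!
... | inj₁ p∣n = ℕP.<⇒≱ n<p (∣⇒≤ p∣n)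
... | inj₂ p∣n! = prime∤! p-prime (ℕP.<-trans (ℕP.n<1+n n) n<p) p∣n!

prime∣choose : ∀ {p k} → Prime p → 0 ℕ.< k → k ℕ.< p → p ℕ∣.∣ p choose k
prime∣choose {p@(suc q)} {k} p-prime 0<k k<p
  with euclidsLemma (p choose k) (k ! ℕ.* (p ℕ.∸ k) !) p-prime p∣C*!*!
  where
  C*!*!≡p! : (p choose k) ℕ.* (k ! ℕ.* (p ℕ.∸ k) !) ≡ p !
  C*!*!≡p! = trans (cong (ℕ._* (k ! ℕ.* (p ℕ.∸ k) !)) (nCk≡n!/k![n-k]! (ℕP.<⇒≤ k<p)))
                   (m/n*n≡m {{ℕP._!*_!≢0 k (p ℕ.∸ k)}} (k![n∸k]!∣n! (ℕP.<⇒≤ k<p)))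
  p∣C*!*! : p ℕ∣.∣ (p choose k) ℕ.* (k ! ℕ.* (p ℕ.∸ k) !)
  p∣C*!*! = subst (p ℕ∣.∣_) (sym C*!*!≡p!) (m∣m*n (q !))
... | inj₁ p∣C = p∣C
... | inj₂ p∣!*! with euclidsLemma (k !) ((p ℕ.∸ k) !) p-prime p∣!*!
...   | inj₁ p∣k! = ⊥-elim (prime∤! p-prime k<p p∣k!)
...   | inj₂ p∣[p-k]! = ⊥-elim (prime∤! p-prime (ℕP.∸-monoʳ-< 0<k (ℕP.<⇒≤ k<p)) p∣[p-k]!)

module Frobenius {c ℓ} (S : CommutativeSemiring c ℓ) where

  open CommutativeSemiring S renaming (refl to ≈-refl; trans to ≈-trans) hiding (sym)
  open import Algebra.Properties.CommutativeSemiring.Binomial S using (theorem; binomialTerm)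
  open import Algebra.Properties.Semiring.Exp semiring using () renaming (_^_ to _^ₛ_)
  open import Algebra.Properties.Monoid.Mult +-monoid using (×-homo-+) renaming (_×_ to _×ₙ_)
  open import Algebra.Properties.Monoid.Sum +-monoid using (sum; sum-init-last; sum-cong-≋; sum-replicate-zero)
  open import Relation.Binary.Reasoning.Setoid setoid
  import Data.Vec.Functional as Vector

  multiple×≈0 : ∀ {p} → (∀ x → p ×ₙ x ≈ 0#) → ∀ {n} x → p ℕ∣.∣ n → n ×ₙ x ≈ 0#
  multiple×≈0 {p} char-p x (ℕ∣.divides k refl) = go k
    where
    go : ∀ k → (k ℕ.* p) ×ₙ x ≈ 0#
    go zero    = ≈-refl
    go (suc k) = ≈-trans (×-homo-+ x p (k ℕ.* p)) (≈-trans (+-cong (char-p x) (go k)) (+-identityʳ 0#))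

  frobenius : ∀ {p} → Prime p → (∀ x → p ×ₙ x ≈ 0#) → ∀ x y → (x + y) ^ₛ p ≈ x ^ₛ p + y ^ₛ p
  frobenius {p@(suc q)} p-prime char-p x y = begin
    (x + y) ^ₛ p                                              ≈⟨ theorem p x y ⟩
    binomialTerm x y p Fin.zero + sum inner
      ≈⟨ +-cong (≈-trans (+-identityʳ _) (*-identityˡ _)) (sum-init-last inner) ⟩
    y ^ₛ p + (sum (Vector.init inner) + inner (Fin.fromℕ q))  ≈⟨ +-congˡ (+-cong middle≈0 last≈x^p) ⟩
    y ^ₛ p + (0# + x ^ₛ p)                                    ≈⟨ +-congˡ (+-identityˡ _) ⟩
    y ^ₛ p + x ^ₛ p                                           ≈⟨ +-comm _ _ ⟩
    x ^ₛ p + y ^ₛ p                                           ∎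
    where
    inner : Fin p → Carrier
    inner k = binomialTerm x y p (Fin.suc k)
    middle≈0 : sum (Vector.init inner) ≈ 0#
    middle≈0 = ≈-trans (sum-cong-≋ λ i → multiple×≈0 char-p _ (prime∣choose p-prime ℕ.z<s
                       (ℕ.s≤s (subst (ℕ._< q) (sym (FinP.toℕ-inject₁ i)) (FinP.toℕ<n i)))))
                     (sum-replicate-zero q)
    last≈x^p : inner (Fin.fromℕ q) ≈ x ^ₛ p
    last≈x^p rewrite FinP.toℕ-fromℕ q | nCn≡1 p | ℕP.n∸n≡0 q = ≈-trans (+-identityʳ _) (*-identityʳ _)

module Fermat {p : ℕ} (p-prime : Prime p) where

  open IntegersModulo p
  open CommutativeSemiring ℤ/mℤ using (semiring; +-monoid)
  open import Algebra.Properties.Semiring.Exp semiring using () renaming (_^_ to _^ₛ_)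
  open import Algebra.Properties.Monoid.Mult +-monoid using () renaming (_×_ to _×ₙ_)
  open Frobenius ℤ/mℤ using (frobenius)

  ^ₛ≡^ : ∀ a n → a ^ₛ n ≡ a ℤ.^ n
  ^ₛ≡^ a zero    = refl
  ^ₛ≡^ a (suc n) = cong (a ℤ.*_) (^ₛ≡^ a n)

  ×ₙ≡* : ∀ n a → n ×ₙ a ≡ + n ℤ.* a
  ×ₙ≡* zero    a = sym (ℤP.*-zeroˡ a)
  ×ₙ≡* (suc n) a = trans (cong (λ s → a ℤ.+ s) (×ₙ≡* n a)) (expand a (+ n))
    where expand : ∀ a k → a ℤ.+ k ℤ.* a ≡ (+ 1 ℤ.+ k) ℤ.* a
          expand = solve-∀

  characteristic : ∀ a → p ×ₙ a ≋ + 0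
  characteristic a = mk≋ (Signed.divides a (trans (ℤP.+-identityʳ _) (trans (×ₙ≡* p a) (ℤP.*-comm (+ p) a))))

  frobeniusℤ : ∀ a b → (a ℤ.+ b) ℤ.^ p ≋ a ℤ.^ p ℤ.+ b ℤ.^ p
  frobeniusℤ a b = subst₂ _≋_ (^ₛ≡^ (a ℤ.+ b) p) (cong₂ ℤ._+_ (^ₛ≡^ a p) (^ₛ≡^ b p))
                          (frobenius p-prime characteristic a b)

  0^p≡0 : (+ 0) ℤ.^ p ≡ + 0
  0^p≡0 = zero^ (ℕP.<⇒≤ (prime>1 p-prime))
    where zero^ : ∀ {n} → 0 ℕ.< n → (+ 0) ℤ.^ n ≡ + 0
          zero^ {suc n} _ = refl

  fermatℕ : ∀ n → (+ n) ℤ.^ p ≋ + n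
  fermatℕ zero    = ≡⇒≋ 0^p≡0
  fermatℕ (suc n) = ≋-trans (frobeniusℤ (+ 1) (+ n)) (+-cong (≡⇒≋ (ℤP.^-zeroˡ p)) (fermatℕ n))

  fermat : ∀ a → a ℤ.^ p ≋ a
  fermat (+ n)    = fermatℕ n
  fermat -[1+ n ] = +-cancelʳ-≋ (begin
    -[1+ n ] ℤ.^ p ℤ.+ (+ suc n) ℤ.^ p  ≈⟨ frobeniusℤ -[1+ n ] (+ suc n) ⟨
    (-[1+ n ] ℤ.+ + suc n) ℤ.^ p        ≡⟨ cong (ℤ._^ p) (ℤP.+-inverseˡ (+ suc n)) ⟩
    (+ 0) ℤ.^ p                         ≡⟨ 0^p≡0 ⟩
    + 0                                 ≡⟨ ℤP.+-inverseˡ (+ suc n) ⟨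
    -[1+ n ] ℤ.+ + suc n                ≈⟨ +-cong (≋-refl { -[1+ n ] }) (fermatℕ (suc n)) ⟨
    -[1+ n ] ℤ.+ (+ suc n) ℤ.^ p        ∎)
    where open import Relation.Binary.Reasoning.Setoid ≋-setoid

module Cartier (p : ℕ) .{{_ : ℕ.NonZero p}} where

  Frob : LaurentPoly r → LaurentPoly r
  Frob = List.map λ (a , f) → (a , scale p f)

  Frob-· : (A B : LaurentPoly r) → Frob (A · B) ≡ Frob A · Frob B
  Frob-· []      B = refl
  Frob-· (s ∷ A) B = begin
    Frob (List.map (s ⊗_) B ++ A · B)                      ≡⟨ ListP.map-++ _ (List.map (s ⊗_) B) (A · B) ⟩
    Frob (List.map (s ⊗_) B) ++ Frob (A · B)               ≡⟨ cong₂ _++_ map-⊗ (Frob-· A B) ⟩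
    List.map ((proj₁ s , scale p (proj₂ s)) ⊗_) (Frob B) ++ Frob A · Frob B ∎
    where
    open ≡-Reasoning
    map-⊗ : Frob (List.map (s ⊗_) B) ≡ List.map ((proj₁ s , scale p (proj₂ s)) ⊗_) (Frob B)
    map-⊗ = trans (sym (ListP.map-∘ B))
                  (trans (ListP.map-cong (λ t → cong (_ ,_) (scale-⊕ p (proj₂ s) (proj₂ t))) B) (ListP.map-∘ B))

  Frob-^ : (P : LaurentPoly r) (n : ℕ) → Frob (P ^ n) ≡ Frob P ^ n
  Frob-^ P zero    = cong (λ e → (+ 1 , e) ∷ []) (scale-0ᵐ p)
  Frob-^ P (suc n) = trans (Frob-· P (P ^ n)) (cong (Frob P ·_) (Frob-^ P n))

  coeff-Frob-scale : (S : LaurentPoly r) (g : Monomial r) → coeff (Frob S) (scale p g) ≡ coeff S g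
  coeff-Frob-scale S g = begin
    coeff (Frob S) (scale p g)            ≡⟨ coeff≡∑ (Frob S) (scale p g) ⟩
    ∑ (coeffₜ (scale p g)) (Frob S)       ≡⟨ ∑-map (coeffₜ (scale p g)) _ S ⟩
    ∑ (λ (a , f) → a ℤ.* δ (scale p f) (scale p g)) S
      ≡⟨ ∑-cong (λ (a , f) → cong (a ℤ.*_) (δ-cong (mk⇔ (scale-injective p f g) (cong (scale p))))) S ⟩
    ∑ (coeffₜ g) S                        ≡⟨ coeff≡∑ S g ⟨
    coeff S g                             ∎
    where open ≡-Reasoning

  coeff-Frob-unscaled : (S : LaurentPoly r) {e : Monomial r} → (∀ g → scale p g ≢ e) → coeff (Frob S) e ≡ + 0
  coeff-Frob-unscaled S {e} unscaled = begin
    coeff (Frob S) e                                 ≡⟨ coeff≡∑ (Frob S) e ⟩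
    ∑ (coeffₜ e) (Frob S)                            ≡⟨ ∑-map (coeffₜ e) _ S ⟩
    ∑ (λ (a , f) → a ℤ.* δ (scale p f) e) S          ≡⟨ ∑-cong (λ (a , f) → coeffₜ-≢ a (unscaled f)) S ⟩
    ∑ (λ _ → + 0) S                                  ≡⟨ ∑-zero S ⟩
    + 0                                              ∎
    where open ≡-Reasoning

  scaled? : (f : Monomial r) → Dec (∃ λ h → scale p h ≡ f)
  scaled? []      = yes ([] , refl)
  scaled? (z ∷ f) with + p Signed.∣? z | scaled? f
  ... | yes (Signed.divides k z≡kp) | yes (h , ph≡f) = yes (k ∷ h , cong₂ _∷_ (sym z≡kp) ph≡f)
  ... | yes _ | no  f-unscaled = no λ { (_ ∷ h , ph≡z∷f) → f-unscaled (h , VecP.∷-injectiveʳ ph≡z∷f) }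
  ... | no  p∤z | _ = no λ { (k ∷ _ , ph≡z∷f) → p∤z (Signed.divides k (sym (VecP.∷-injectiveˡ ph≡z∷f))) }

  Λ : LaurentPoly r → LaurentPoly r
  Λ []            = []
  Λ ((a , f) ∷ X) with scaled? f
  ... | yes (h , _) = (a , h) ∷ Λ X
  ... | no  _       = Λ X

  coeff-Λ : (X : LaurentPoly r) (h : Monomial r) → coeff (Λ X) h ≡ coeff X (scale p h)
  coeff-Λ X h = trans (coeff≡∑ (Λ X) h) (trans (go X) (sym (coeff≡∑ X (scale p h))))
    where
    go : ∀ X → ∑ (coeffₜ h) (Λ X) ≡ ∑ (coeffₜ (scale p h)) X
    go []            = refl
    go ((a , f) ∷ X) with scaled? f
    ... | yes (g , refl) =
      cong₂ ℤ._+_ (cong (a ℤ.*_) (δ-cong (mk⇔ (cong (scale p)) (scale-injective p g h)))) (go X)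
    ... | no  f-unscaled =
      trans (go X) (sym (∑-head-zero _ (a , f) X (coeffₜ-≢ a λ f≡ph → f-unscaled (h , sym f≡ph))))

  ct-Λ : (X : LaurentPoly r) → ct (Λ X) ≡ ct X
  ct-Λ X = trans (coeff-Λ X 0ᵐ) (cong (coeff X) (scale-0ᵐ p))

  Bounded-Λ : ∀ {d} (X : LaurentPoly r) → Bounded (d ℕ.* p) X → Bounded d (Λ X)
  Bounded-Λ []            []         = []
  Bounded-Λ ((a , f) ∷ X) (f≤ ∷ X≤) with scaled? f
  ... | yes (h , refl) =
    ℕP.*-cancelʳ-≤ (maxAbs h) _ p (subst (ℕ._≤ _) (maxAbs-scale p h) f≤) ∷ Bounded-Λ X X≤
  ... | no  _          = Bounded-Λ X X≤

  -- A term of R can only reach an exponent in pℤʳ against Frob S if its own exponent lies in pℤʳ.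
  Λ-·-Frob : (R S : LaurentPoly r) → coeff (Λ (R · Frob S)) ≗ coeff (Λ R · S)
  Λ-·-Frob R S h = begin
    coeff (Λ (R · Frob S)) h                                          ≡⟨ coeff-Λ (R · Frob S) h ⟩
    coeff (R · Frob S) (scale p h)                                    ≡⟨ coeff-·-shift R (Frob S) (scale p h) ⟩
    ∑ (λ (a , f) → a ℤ.* coeff (Frob S) (scale p h ⊝ f)) R             ≡⟨ go R ⟩
    ∑ (λ (a , g) → a ℤ.* coeff S (h ⊝ g)) (Λ R)                       ≡⟨ coeff-·-shift (Λ R) S h ⟨
    coeff (Λ R · S) h                                                 ∎
    where
    open ≡-Reasoning
    go : ∀ R → ∑ (λ (a , f) → a ℤ.* coeff (Frob S) (scale p h ⊝ f)) R
             ≡ ∑ (λ (a , g) → a ℤ.* coeff S (h ⊝ g)) (Λ R)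
    go []            = refl
    go ((a , f) ∷ R) with scaled? f
    ... | yes (g , refl) = cong₂ ℤ._+_ (cong (a ℤ.*_) (trans (cong (coeff (Frob S)) (sym (scale-⊝ p h g)))
                                                            (coeff-Frob-scale S (h ⊝ g))))
                                       (go R)
    ... | no  f-unscaled = trans (∑-head-zero _ (a , f) R head≡0) (go R)
      where
      unscaled : ∀ k → scale p k ≢ scale p h ⊝ f
      unscaled k pk≡ph-f =
        f-unscaled (h ⊝ k , trans (scale-⊝ p h k) (⊝≡⇒⊝≡ (scale p h) f (scale p k) (sym pk≡ph-f)))
      head≡0 : a ℤ.* coeff (Frob S) (scale p h ⊝ f) ≡ + 0
      head≡0 = trans (cong (a ℤ.*_) (coeff-Frob-unscaled S unscaled)) (ℤP.*-zeroʳ a)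

module LaurentFrobenius {p : ℕ} (p-prime : Prime p) (r : ℕ) where

  private instance
    p≢0 : ℕ.NonZero p
    p≢0 = prime⇒nonZero p-prime

  open IntegersModulo p
  open LaurentPolynomialsModulo p r
  open Cartier p using (Frob)
  open CommutativeSemiring Poly using (+-monoid)
  open import Algebra.Properties.Monoid.Mult +-monoid using () renaming (_×_ to _×ₙ_)
  open Frobenius Poly using (frobenius)
  open Fermat p-prime using (fermat)

  coeff-×ₙ : ∀ n P e → coeff (n ×ₙ P) e ≡ + n ℤ.* coeff P e
  coeff-×ₙ zero    P e = sym (ℤP.*-zeroˡ (coeff P e))
  coeff-×ₙ (suc n) P e = trans (coeff-++ P (n ×ₙ P) e)
                               (trans (cong (λ c → coeff P e ℤ.+ c) (coeff-×ₙ n P e)) (expand (coeff P e) (+ n)))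
    where expand : ∀ a k → a ℤ.+ k ℤ.* a ≡ (+ 1 ℤ.+ k) ℤ.* a
          expand = solve-∀

  characteristic : ∀ P → p ×ₙ P ≈ []
  characteristic P = mk≈ λ e →
    mk≋ (Signed.divides (coeff P e) (trans (ℤP.+-identityʳ _) (trans (coeff-×ₙ p P e) (ℤP.*-comm (+ p) _))))

  frobenius-++ : ∀ A B → (A ++ B) ^ p ≈ A ^ p ++ B ^ p
  frobenius-++ A B = subst₂ _≈_ (^ₛ≡^ (A ++ B) p) (cong₂ _++_ (^ₛ≡^ A p) (^ₛ≡^ B p))
                            (frobenius p-prime characteristic A B)

  term-^ : ∀ a (f : Monomial r) n → ((a , f) ∷ []) ^ n ≡ (a ℤ.^ n , scale n f) ∷ []
  term-^ a f zero    = cong (λ e → (+ 1 , e) ∷ []) (sym (scale-zero f))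
  term-^ a f (suc n) = trans (cong (((a , f) ∷ []) ·_) (term-^ a f n))
                             (cong (λ e → (a ℤ.* a ℤ.^ n , e) ∷ []) (sym (scale-suc n f)))

  []-^ : ∀ {n} → 0 ℕ.< n → ([] ^ n) ≡ ([] {A = Term r})
  []-^ {suc n} _ = refl

  ^p≈Frob : ∀ P → P ^ p ≈ Frob P
  ^p≈Frob []            = ≡⇒≈ ([]-^ (ℕP.<⇒≤ (prime>1 p-prime)))
  ^p≈Frob ((a , f) ∷ P) = ≈-trans (frobenius-++ ((a , f) ∷ []) P) (++-cong term≈ (^p≈Frob P))
    where
    term≈ : ((a , f) ∷ []) ^ p ≈ (a , scale p f) ∷ []
    term≈ = subst (_≈ ((a , scale p f) ∷ [])) (sym (term-^ a f p)) (term-cong (scale p f) (fermat a))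

fromDigits<base^length : ∀ {b} (ds : Expansion b) → fromDigits ds ℕ.< b ℕ.^ List.length ds
fromDigits<base^length         []       = ℕ.s≤s ℕ.z≤n
fromDigits<base^length {b} (a ∷ ds) = ℕP.<-≤-trans (ℕP.+-monoˡ-< (fromDigits ds ℕ.* b) (FinP.toℕ<n a))
  (ℕP.≤-trans (ℕP.*-monoˡ-≤ b (fromDigits<base^length ds)) (ℕP.≤-reflexive (ℕP.*-comm _ b)))

module DigitRecursion {p : ℕ} (p-prime : Prime p) (r : ℕ) where

  private instance
    p≢0 : ℕ.NonZero p
    p≢0 = prime⇒nonZero p-prime

  open IntegersModulo p
  open LaurentPolynomialsModulo p r
  open Cartier p
  open LaurentFrobenius p-prime r using (^p≈Frob)
  open import Relation.Binary.Reasoning.Setoid ≋-setoid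

  step : LaurentPoly r → LaurentPoly r → Fin p → LaurentPoly r
  step P Q a = Λ (Q · (P ^ toℕ a))

  ct-step : ∀ P Q a m → ct (Q · (P ^ (toℕ a ℕ.+ m ℕ.* p))) ≋ ct (step P Q a · (P ^ m))
  ct-step P Q a m = begin
    ct (Q · (P ^ (toℕ a ℕ.+ m ℕ.* p)))          ≈⟨ ct-cong Q·P^[a+mp]≈ ⟩
    ct ((Q · (P ^ toℕ a)) · Frob (P ^ m))       ≡⟨ ct-Λ ((Q · (P ^ toℕ a)) · Frob (P ^ m)) ⟨
    ct (Λ ((Q · (P ^ toℕ a)) · Frob (P ^ m)))   ≡⟨ Λ-·-Frob (Q · (P ^ toℕ a)) (P ^ m) 0ᵐ ⟩
    ct (step P Q a · (P ^ m))                   ∎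
    where
    P^mp≈ : P ^ (m ℕ.* p) ≈ Frob (P ^ m)
    P^mp≈ = ≈-trans (≡⇒≈ (cong (P ^_) (ℕP.*-comm m p))) (≈-trans (^-* P p m)
              (≈-trans (^-cong m (^p≈Frob P)) (≡⇒≈ (sym (Frob-^ P m)))))
    Q·P^[a+mp]≈ : Q · (P ^ (toℕ a ℕ.+ m ℕ.* p)) ≈ (Q · (P ^ toℕ a)) · Frob (P ^ m)
    Q·P^[a+mp]≈ = ≈-trans (·-congˡ Q (≈-trans (^-+ P (toℕ a) (m ℕ.* p)) (·-congˡ (P ^ toℕ a) P^mp≈)))
                          (≈-sym (≗⇒≈ (coeff-·-assoc Q (P ^ toℕ a) (Frob (P ^ m)))))

  run : LaurentPoly r → LaurentPoly r → Expansion p → LaurentPoly r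
  run P = List.foldl (step P)

  ct-run : ∀ P Q ds → ct (Q · (P ^ fromDigits ds)) ≋ ct (run P Q ds)
  ct-run P Q []       = ≡⇒≋ (trans (coeff-·-comm Q one 0ᵐ) (cong ct (·-identityˡ Q)))
  ct-run P Q (a ∷ ds) = ≋-trans (ct-step P Q a (fromDigits ds)) (ct-run P (step P Q a) ds)

  ct-^-run : ∀ P ds → ct (P ^ fromDigits ds) ≋ ct (run P one ds)
  ct-^-run P ds = subst (λ X → ct X ≋ ct (run P one ds)) (·-identityˡ (P ^ fromDigits ds)) (ct-run P one ds)

  Λ-cong : {X Y : LaurentPoly r} → X ≈ Y → Λ X ≈ Λ Y
  Λ-cong {X} {Y} (mk≈ X≋Y) = mk≈ λ h → subst₂ _≋_ (sym (coeff-Λ X h)) (sym (coeff-Λ Y h)) (X≋Y (scale p h))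

  run-cong : ∀ P {Q Q′} ds → Q ≈ Q′ → run P Q ds ≈ run P Q′ ds
  run-cong P []       Q≈Q′ = Q≈Q′
  run-cong P (a ∷ ds) Q≈Q′ = run-cong P ds (Λ-cong (·-cong Q≈Q′ ≈-refl))

  Bounded-step : ∀ {d P Q} a → Bounded d P → Bounded d Q → Bounded d (step P Q a)
  Bounded-step {d} {P} {Q} a P≤ Q≤ =
    Bounded-Λ (Q · (P ^ toℕ a)) (Bounded-mono d+ad≤dp (Bounded-· Q (P ^ toℕ a) Q≤ (Bounded-^ P (toℕ a) P≤)))
    where d+ad≤dp : d ℕ.+ toℕ a ℕ.* d ℕ.≤ d ℕ.* p
          d+ad≤dp = ℕP.≤-trans (ℕP.*-monoˡ-≤ d (FinP.toℕ<n a)) (ℕP.≤-reflexive (ℕP.*-comm p d))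

  Bounded-run : ∀ {d P Q} ds → Bounded d P → Bounded d Q → Bounded d (run P Q ds)
  Bounded-run []       P≤ Q≤ = Q≤
  Bounded-run (a ∷ ds) P≤ Q≤ = Bounded-run ds P≤ (Bounded-step a P≤ Q≤)

module StateCodes (p : ℕ) .{{_ : ℕ.NonZero p}} (r : ℕ) where

  open IntegersModulo p
  open LaurentPolynomialsModulo p r

  residue : ℤ → Fin p
  residue a = Fin.fromℕ< (n%ℕd<d a p)

  ≋-%ℕ : ∀ a → a ≋ + (a %ℕ p)
  ≋-%ℕ a = mk≋ (Signed.divides (a /ℕ p) (trans (cong (ℤ._- + (a %ℕ p)) (a≡a%ℕn+[a/ℕn]*n a p))
                                            (cancel (+ (a %ℕ p)) (a /ℕ p ℤ.* + p))))
    where cancel : ∀ x y → (x ℤ.+ y) ℤ.- x ≡ y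
          cancel = solve-∀

  residue-≋ : ∀ {a b} → residue a ≡ residue b → a ≋ b
  residue-≋ {a} {b} eq = ≋-trans (≋-%ℕ a) (≋-trans (≡⇒≋ (cong +_ %≡)) (≋-sym (≋-%ℕ b)))
    where %≡ : a %ℕ p ≡ b %ℕ p
          %≡ = trans (sym (FinP.toℕ-fromℕ< _)) (trans (cong toℕ eq) (FinP.toℕ-fromℕ< _))

  code : ∀ d → LaurentPoly r → Fin (p ℕ.^ List.length (box r d))
  code d Q = Fin.funToFin λ i → residue (coeff Q (List.lookup (box r d) i))

  code-injective : ∀ {d Q Q′} → Bounded d Q → Bounded d Q′ → code d Q ≡ code d Q′ → Q ≈ Q′
  code-injective {d} {Q} {Q′} Q≤ Q′≤ codes≡ = mk≈ λ e → compare e (maxAbs e ℕ.≤? d)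
    where
    residues≡ : ∀ i → residue (coeff Q (List.lookup (box r d) i)) ≡ residue (coeff Q′ (List.lookup (box r d) i))
    residues≡ i = trans (sym (FinP.finToFun-funToFin _ i))
                        (trans (cong (λ c → Fin.finToFun c i) codes≡) (FinP.finToFun-funToFin _ i))
    compare : ∀ e → Dec (maxAbs e ℕ.≤ d) → coeff Q e ≋ coeff Q′ e
    compare e (yes e≤d) = subst (λ e → coeff Q e ≋ coeff Q′ e) (sym (AnyP.lookup-index e∈box))
                                (residue-≋ (residues≡ (Any.index e∈box)))
      where e∈box = ∈-box e e≤d
    compare e (no  e≰d) = ≡⇒≋ (trans (coeff-outside Q Q≤ e≰d) (sym (coeff-outside Q′ Q′≤ e≰d)))

module ShortestRun {p : ℕ} (p-prime : Prime p) (r : ℕ) where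

  private instance
    p≢0 : ℕ.NonZero p
    p≢0 = prime⇒nonZero p-prime

  open LaurentPolynomialsModulo p r
  open DigitRecursion p-prime r
  open StateCodes p r

  stateCount : ℕ → ℕ
  stateCount d = p ℕ.^ List.length (box r d)

  shorten : ∀ {d P} → Bounded d P → ∀ ds → stateCount d ℕ.< List.length ds →
            ∃ λ ds′ → List.length ds′ ℕ.< List.length ds × run P one ds′ ≈ run P one ds
  shorten {d} {P} P≤ ds N<len
    with i , j , i<j , codes≡ ← FinP.pigeonhole (ℕP.n<1+n (stateCount d))
                                                (λ i → code d (run P one (List.take (toℕ i) ds)))
    = List.take (toℕ i) ds ++ List.drop (toℕ j) ds , shorter , skip-loop
    where
    Bounded-prefix : ∀ k → Bounded d (run P one (List.take k ds))
    Bounded-prefix k = Bounded-run (List.take k ds) P≤ (Bounded-one d)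
    skip-loop : run P one (List.take (toℕ i) ds ++ List.drop (toℕ j) ds) ≈ run P one ds
    skip-loop = subst₂ _≈_ (sym (ListP.foldl-++ (step P) one (List.take (toℕ i) ds) _))
      (trans (sym (ListP.foldl-++ (step P) one (List.take (toℕ j) ds) _))
             (cong (run P one) (ListP.take++drop≡id (toℕ j) ds)))
      (run-cong P (List.drop (toℕ j) ds) (code-injective (Bounded-prefix (toℕ i)) (Bounded-prefix (toℕ j)) codes≡))
    shorter : List.length (List.take (toℕ i) ds ++ List.drop (toℕ j) ds) ℕ.< List.length ds
    shorter = begin-strict
      List.length (List.take (toℕ i) ds ++ List.drop (toℕ j) ds)   ≡⟨ ListP.length-++ (List.take (toℕ i) ds) ⟩
      List.length (List.take (toℕ i) ds) ℕ.+ List.length (List.drop (toℕ j) ds)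
        ≡⟨ cong₂ ℕ._+_ (ListP.length-take (toℕ i) ds) (ListP.length-drop (toℕ j) ds) ⟩
      toℕ i ℕ.⊓ List.length ds ℕ.+ (List.length ds ℕ.∸ toℕ j)      ≤⟨ ℕP.+-monoˡ-≤ _ (ℕP.m⊓n≤m (toℕ i) _) ⟩
      toℕ i ℕ.+ (List.length ds ℕ.∸ toℕ j)                          <⟨ ℕP.+-monoˡ-< _ i<j ⟩
      toℕ j ℕ.+ (List.length ds ℕ.∸ toℕ j)                          ≡⟨ ℕP.m+[n∸m]≡n j≤len ⟩
      List.length ds                                                ∎
      where
      open ℕP.≤-Reasoning
      j≤len : toℕ j ℕ.≤ List.length ds
      j≤len = ℕP.≤-trans (ℕP.≤-pred (FinP.toℕ<n j)) (ℕP.<⇒≤ N<len)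

  shortest : ∀ {d P} → Bounded d P → ∀ ds →
             ∃ λ ds′ → List.length ds′ ℕ.≤ stateCount d × run P one ds′ ≈ run P one ds
  shortest {d} {P} P≤ ds = go ds (ℕI.<-wellFounded (List.length ds))
    where
    go : ∀ ds → Acc ℕ._<_ (List.length ds) →
         ∃ λ ds′ → List.length ds′ ℕ.≤ stateCount d × run P one ds′ ≈ run P one ds
    go ds (acc shorter) with List.length ds ℕ.≤? stateCount d
    ... | yes len≤N = ds , len≤N , ≈-refl
    ... | no  len≰N with ds′ , ds′<ds , ds′≈ds ← shorten P≤ ds (ℕP.≰⇒> len≰N)
                    with ds″ , len≤N , ds″≈ds′ ← go ds′ (shorter ds′<ds)
                    = ds″ , len≤N , ≈-trans ds″≈ds′ ds′≈ds

proposition12 : (r p : ℕ) → Prime p →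
    Σ (ℕ → ℕ) λ B → (P : LaurentPoly r) →
      ∃ (λ n → (+ p) ∣ ct (P ^ n)) →
      ∃ (λ n₀ → n₀ < B (deg P) × (+ p) ∣ ct (P ^ n₀))
proposition12 r p p-prime = (λ d → p ℕ.^ stateCount d) , small-exponent
  where
  instance
    p≢0 : ℕ.NonZero p
    p≢0 = prime⇒nonZero p-prime
  open IntegersModulo p
  open LaurentPolynomialsModulo p r
  open DigitRecursion p-prime r
  open ShortestRun p-prime r
  open import Relation.Binary.Reasoning.Setoid ≋-setoid

  small-exponent : (P : LaurentPoly r) → ∃ (λ n → (+ p) ∣ ct (P ^ n)) →
                   ∃ (λ n₀ → n₀ < p ℕ.^ stateCount (deg P) × (+ p) ∣ ct (P ^ n₀))
  small-exponent P (n , p∣ctPⁿ)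
    with ds , ds≡n ← toDigits p {fromWitness (prime>1 p-prime)} n
    with ds′ , ds′-short , ds′~ds ← shortest (Bounded-restrict (deg P) P) ds
    = fromDigits ds′
    , ℕP.<-≤-trans (fromDigits<base^length ds′) (ℕP.^-monoʳ-≤ p ds′-short)
    , ≋0⇒∣ (begin
      ct (P ^ fromDigits ds′)    ≈⟨ ct-cong (^-cong (fromDigits ds′) P≈P′) ⟩
      ct (P′ ^ fromDigits ds′)   ≈⟨ ct-^-run P′ ds′ ⟩
      ct (run P′ one ds′)        ≈⟨ ct-cong ds′~ds ⟩
      ct (run P′ one ds)         ≈⟨ ct-^-run P′ ds ⟨
      ct (P′ ^ fromDigits ds)    ≡⟨ cong (λ k → ct (P′ ^ k)) ds≡n ⟩
      ct (P′ ^ n)                ≈⟨ ct-cong (^-cong n P≈P′) ⟨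
      ct (P ^ n)                 ≈⟨ ∣⇒≋0 p∣ctPⁿ ⟩
      + 0                        ∎)
    where
    P′ = restrict (deg P) P
    P≈P′ : P ≈ P′
    P≈P′ = ≈-sym (≗⇒≈ (coeff-restrict-deg P))
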